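{- Let $H$ and $D$ be digraphs and let $v_0,v_0^*\in V(D)$ be distinct. Suppose $L\subseteq D$ is a ladder from $v_0$ to $v_0^*$ that is embedded in an $H$-subdivision $H'$ in $D$. Then for every path $P$ in $D$ from $v_0$ to $v_0^*$ that is internally vertex-disjoint from $H'$, there exists an $H$-subdivision $H''$ in $D$ with the same branch-vertices as $H'$ and with $V(H'')=V(H')\cup V(P)$.
   Context: Paths are directed. An $H$-subdivision in $D$ is a pair of maps $f:V(H)\to V(D)$ (injective) and $g$ from $A(H)$ to paths of $D$ such that $g(uv)$ is a path from $f(u)$ to $f(v)$ and paths for distinct arcs are internally vertex-disjoint; $f(V(H))$ are its branch-vertices, the $g(a)$ its subdivided paths, and its vertex set is the union of the vertices of all subdivided paths and branch-vertices. An alternating path $Q=[v_0v_1\cdots v_{2k}v_{2k}^*v_{2k-1}^*\cdots v_0^*]$ is a subdigraph of $D$ on distinct vertices $v_0,\ldots,v_{2k},v_{2k}^*,\ldots,v_0^*$ whose arcs are $v_iv_{i+1}$ and $v_{i+1}^*v_i^*$ for even $i\in\{0,2,\ldots,2k-2\}$, the arc $v_{2k}v_{2k}^*$, and $v_{j+1}v_j$ and $v_j^*v_{j+1}^*$ for odd $j\in\{1,3,\ldots,2k-1\}$. A ladder from $v_0$ to $v_0^*$ is a subdigraph $L=Q\cup Q_1\cup Q_3\cup\cdots\cup Q_{2k-1}$ where $Q$ is such an alternating path and each $Q_i$ ($i$ odd) is a path from $v_i$ to $v_i^*$, the $Q_i$ pairwise vertex-disjoint and internally vertex-disjoint from $Q$.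 Its rung paths are $R_i=v_iv_{i+1}Q_{i+1}v_{i+1}^*v_i^*$ for $i=0,2,\ldots,2k-2$ and $R_{2k}=v_{2k}v_{2k}^*$. The ladder $L$ is embedded in an $H$-subdivision $H'$ if all rung paths $R_0,R_2,\ldots,R_{2k}$ are subpaths of one single subdivided path of $H'$. -}

module Defs where

open import Data.Nat using (ℕ; zero; suc; _+_; _*_; _≤_; _<_)
open import Data.Fin using (Fin)
open import Data.Bool using (Bool; T)
open import Data.List using (List; []; _∷_; [_]; _++_)
open import Data.List.Membership.Propositional using (_∈_; _∉_)
open import Data.List.Relation.Unary.Unique.Propositional using (Unique)
open import Data.Product using (Σ; ∃; ∃-syntax; _×_; _,_)
open import Data.Sum using (_⊎_)
open import Relation.Binary.PropositionalEquality using (_≡_; _≢_)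
open import Relation.Nullary using (¬_)
open import Function.Bundles using (_⇔_)

record Digraph : Set where
  field
    n   : ℕ
    adj : Fin n → Fin n → Bool

open Digraph public

V : Digraph → Set
V D = Fin (n D)

Arc : (D : Digraph) → V D → V D → Set
Arc D u v = T (adj D u v)

data IsWalk (D : Digraph) : V D → V D → List (V D) → Set where
  here : ∀ {x} → IsWalk D x x [ x ]
  step : ∀ {x y z vs} → Arc D x y → IsWalk D y z vs → IsWalk D x z (x ∷ vs)

IsPath : (D : Digraph) → V D → V D → List (V D) → Set
IsPath D x y vs = IsWalk D x y vs × Unique vs

Internal : {A : Set} → A → A → List A → A → Set
Internal x y vs z = z ∈ vs × z ≢ x × z ≢ y

IntDisjoint : {A : Set} → A → A → List A → A → A → List A → Set
IntDisjoint x y ps x' y' qs =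
  (∀ z → Internal x y ps z → z ∉ qs) × (∀ z → Internal x' y' qs z → z ∉ ps)

Subpath : {A : Set} → List A → List A → Set
Subpath {A} rs ps = Σ (List A) λ pre → Σ (List A) λ suf → ps ≡ pre ++ (rs ++ suf)

record Subdivision (H D : Digraph) : Set where
  field
    f     : V H → V D
    f-inj : ∀ u v → f u ≡ f v → u ≡ v
    g     : (u v : V H) → Arc H u v → List (V D)
    g-path : ∀ u v (a : Arc H u v) → IsPath D (f u) (f v) (g u v a)
    g-disj : ∀ u v (a : Arc H u v) u' v' (a' : Arc H u' v') →
             (u , v) ≢ (u' , v') →
             IntDisjoint (f u) (f v) (g u v a) (f u') (f v') (g u' v' a')

open Subdivision public

IsBranch : {H D : Digraph} → Subdivision H D → V D → Set
IsBranch {H} S z = Σ (V H) λ w → f S w ≡ z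

InSub : {H D : Digraph} → Subdivision H D → V D → Set
InSub {H} S z =
  IsBranch S z ⊎ (Σ (V H) λ u → Σ (V H) λ v → Σ (Arc H u v) λ a → z ∈ g S u v a)

-- Ladders.
-- Vertices v i, v* i are given for indices i ≤ 2k (functions on ℕ, only
-- the values at i ≤ 2k matter).  The rung-connecting paths Q_{2m+1}
-- (m < k) are given as vertex lists Qs m.

record Ladder (D : Digraph) (x x* : V D) : Set where
  field
    k    : ℕ
    v    : ℕ → V D
    v*   : ℕ → V D
    Qs   : ℕ → List (V D)
    start  : v 0 ≡ x
    start* : v* 0 ≡ x*
    v-inj   : ∀ i j → i ≤ 2 * k → j ≤ 2 * k → v i ≡ v j → i ≡ j
    v*-inj  : ∀ i j → i ≤ 2 * k → j ≤ 2 * k → v* i ≡ v* j → i ≡ j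
    v-v*    : ∀ i j → i ≤ 2 * k → j ≤ 2 * k → v i ≢ v* j
    -- arcs of the alternating path Q (even i = 2m, odd j = 2m+1, m < k)
    arc-even  : ∀ m → m < k → Arc D (v (2 * m)) (v (suc (2 * m)))
    arc-even* : ∀ m → m < k → Arc D (v* (suc (2 * m))) (v* (2 * m))
    arc-odd   : ∀ m → m < k → Arc D (v (2 + 2 * m)) (v (suc (2 * m)))
    arc-odd*  : ∀ m → m < k → Arc D (v* (suc (2 * m))) (v* (2 + 2 * m))
    arc-top   : Arc D (v (2 * k)) (v* (2 * k))
    Q-path : ∀ m → m < k → IsPath D (v (suc (2 * m))) (v* (suc (2 * m))) (Qs m)
    Q-disj : ∀ m m' → m < k → m' < k → m ≢ m' → ∀ z → z ∈ Qs m → z ∉ Qs m'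
    Q-int  : ∀ m → m < k → ∀ z →
             Internal (v (suc (2 * m))) (v* (suc (2 * m))) (Qs m) z →
             (∀ i → i ≤ 2 * k → z ≢ v i) × (∀ i → i ≤ 2 * k → z ≢ v* i)

open Ladder public

rung : {D : Digraph} {x x* : V D} → Ladder D x x* → ℕ → List (V D)
rung L m = v L (2 * m) ∷ (Qs L m ++ [ v* L (2 * m) ])

topRung : {D : Digraph} {x x* : V D} → Ladder D x x* → List (V D)
topRung L = v L (2 * k L) ∷ [ v* L (2 * k L) ]

EmbeddedIn : {H D : Digraph} {x x* : V D} → Ladder D x x* → Subdivision H D → Set
EmbeddedIn {H} L S =
  Σ (V H) λ u → Σ (V H) λ w → Σ (Arc H u w) λ a →
    (∀ m → m < k L → Subpath (rung L m) (g S u w a)) ×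
    Subpath (topRung L) (g S u w a)

-- Let W be the subdivided path of H' containing all rung paths.  Replace the
-- rung R₀ of W by P: the result is again a path, since P meets W only in its
-- ends v₀, v₀*.  Now the interior Q₁ of R₀ has left W, so the path
-- v₂ v₁ Q₁ v₁* v₂* meets the new path only in its ends and can replace R₂ in the
-- same way, and so on up to the top rung R₂ₖ = v₂ₖ v₂ₖ*.  No vertex is lost:
-- the ends of each removed rung lie on the path replacing it, and its interior
-- on the next replacing path.  Putting the final path in place of W gives H''.
module Submission where

open import Defs
open import Data.Bool.Properties using (T-irrelevant)
open import Data.Empty using (⊥-elim)
open import Data.Fin using (_≟_)
open import Data.List using (List; []; _∷_; [_]; _++_)
open import Data.List.Membership.Propositional using (_∈_; _∉_)
open import Data.List.Membership.Propositional.Properties using (∈-++⁺ˡ; ∈-++⁺ʳ; ∈-++⁻)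
open import Data.List.Properties using (∷-injective; ++-assoc)
open import Data.List.Relation.Binary.Disjoint.Propositional using (Disjoint)
open import Data.List.Relation.Binary.Permutation.Propositional using (_↭_; ↭⇒↭ₛ; ↭-sym)
open import Data.List.Relation.Binary.Permutation.Propositional.Properties using (shifts; ∈-resp-↭)
import Data.List.Relation.Binary.Permutation.Setoid.Properties as PermutationSetoid
open import Data.List.Relation.Binary.Subset.Propositional using (_⊆_)
open import Data.List.Relation.Binary.Subset.Propositional.Properties
  using (⊆-trans; xs⊆xs++ys; xs⊆ys++xs; ++⁺ˡ; ++⁺ʳ)
open import Data.List.Relation.Unary.All as All using ([]; _∷_)
import Data.List.Relation.Unary.All.Properties as All
open import Data.List.Relation.Unary.AllPairs using ([]; _∷_)
open import Data.List.Relation.Unary.Any using (here; there)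
open import Data.List.Relation.Unary.Unique.Propositional using (Unique)
import Data.List.Relation.Unary.Unique.Propositional.Properties as Unique
open import Data.Nat using (ℕ; zero; suc; _*_; _≤_; _<_; z≤n; s≤s)
open import Data.Nat.Properties
  using (*-suc; *-monoʳ-≤; ≤-refl; <-irrefl; <-trans; ≤-trans; ≤-<-trans; <⇒≤; n≤1+n; ≤∧≢⇒<)
  renaming (_≟_ to _≟ℕ_)
open import Data.Product using (Σ; _×_; _,_; proj₁; proj₂; swap)
open import Data.Product.Properties using (≡-dec)
open import Data.Sum using (_⊎_; inj₁; inj₂)
open import Function using (_∘_; id)
open import Function.Bundles using (_⇔_; mk⇔)
import Function.Properties.Equivalence as Equivalence
open import Relation.Binary.Definitions using (DecidableEquality)
open import Relation.Binary.PropositionalEquality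
  using (_≡_; _≢_; refl; sym; trans; cong; subst; subst₂; setoid)
open import Relation.Nullary using (¬_; yes; no)

module _ {A : Set} where

  Unique-resp-↭ : {xs ys : List A} → xs ↭ ys → Unique xs → Unique ys
  Unique-resp-↭ p = PermutationSetoid.Unique-resp-↭ (setoid A) (↭⇒↭ₛ p)

  Unique-++⁻ : ∀ xs {ys : List A} → Unique (xs ++ ys) → Unique xs × Unique ys × Disjoint xs ys
  Unique-++⁻ [] u = [] , u , λ ()
  Unique-++⁻ (x ∷ xs) (x∉ ∷ u) with Unique-++⁻ xs u
  ... | u-xs , u-ys , xs#ys = All.++⁻ˡ xs x∉ ∷ u-xs , u-ys , x∷xs#ys
    where
    x∷xs#ys : Disjoint (x ∷ xs) _
    x∷xs#ys (here refl , x∈ys) = All.lookup (All.++⁻ʳ xs x∉) x∈ys refl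
    x∷xs#ys (there z∈xs , z∈ys) = xs#ys (z∈xs , z∈ys)

  Unique-shift : ∀ pre {mid suf : List A} → Unique (pre ++ mid ++ suf) → Unique (mid ++ pre ++ suf)
  Unique-shift pre {mid} = Unique-resp-↭ (shifts pre mid)

  Unique-unshift : ∀ pre {mid suf : List A} → Unique (mid ++ pre ++ suf) → Unique (pre ++ mid ++ suf)
  Unique-unshift pre {mid} = Unique-resp-↭ (↭-sym (shifts pre mid))

  ∈-middle⁻ : ∀ pre {mid suf : List A} {z} → z ∈ pre ++ mid ++ suf → z ∈ mid ⊎ z ∈ pre ++ suf
  ∈-middle⁻ pre {mid} z∈ = ∈-++⁻ mid (∈-resp-↭ (shifts pre mid) z∈)

  mid⊆pre++mid++suf : ∀ pre {mid suf : List A} → mid ⊆ pre ++ mid ++ suf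
  mid⊆pre++mid++suf pre {mid} {suf} = ⊆-trans (xs⊆xs++ys mid suf) (xs⊆ys++xs _ pre)

  pre++suf⊆pre++mid++suf : ∀ pre {mid suf : List A} → pre ++ suf ⊆ pre ++ mid ++ suf
  pre++suf⊆pre++mid++suf pre {mid} {suf} = ++⁺ʳ pre (xs⊆ys++xs suf mid)

  ++-⊆ : {xs ys zs : List A} → xs ⊆ zs → ys ⊆ zs → xs ++ ys ⊆ zs
  ++-⊆ {xs} xs⊆ ys⊆ z∈ with ∈-++⁻ xs z∈
  ... | inj₁ z∈xs = xs⊆ z∈xs
  ... | inj₂ z∈ys = ys⊆ z∈ys

  swap-middle-⊆ : ∀ pre {R M X suf : List A} → R ⊆ M ++ X → pre ++ R ++ suf ⊆ (pre ++ M ++ suf) ++ X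
  swap-middle-⊆ pre {M = M} R⊆ z∈ with ∈-middle⁻ pre z∈
  ... | inj₂ z∈out = ∈-++⁺ˡ (pre++suf⊆pre++mid++suf pre z∈out)
  ... | inj₁ z∈R with ∈-++⁻ M (R⊆ z∈R)
  ...   | inj₁ z∈M = ∈-++⁺ˡ (mid⊆pre++mid++suf pre z∈M)
  ...   | inj₂ z∈X = ∈-++⁺ʳ _ z∈X

  -- The shape of rung paths; the top rung is the case q = [].
  enclose : A → List A → A → List A
  enclose a q a* = a ∷ (q ++ [ a* ])

  ∈-enclose⁻ : ∀ {a a* z} q → z ∈ enclose a q a* → z ≡ a ⊎ z ∈ q ⊎ z ≡ a*
  ∈-enclose⁻ q (here refl) = inj₁ refl
  ∈-enclose⁻ q (there z∈) with ∈-++⁻ q z∈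
  ... | inj₁ z∈q = inj₂ (inj₁ z∈q)
  ... | inj₂ (here refl) = inj₂ (inj₂ refl)

  ⊆-enclose : ∀ {a a*} q → q ⊆ enclose a q a*
  ⊆-enclose q = there ∘ ∈-++⁺ˡ

  enclose-⊆ : ∀ {a a* q ys} → a ∈ ys → q ⊆ ys → a* ∈ ys → enclose a q a* ⊆ ys
  enclose-⊆ {q = q} a∈ q⊆ a*∈ z∈ with ∈-enclose⁻ q z∈
  ... | inj₁ refl = a∈
  ... | inj₂ (inj₁ z∈q) = q⊆ z∈q
  ... | inj₂ (inj₂ refl) = a*∈

  internal-enclose : ∀ {a a* z} q → Internal a a* (enclose a q a*) z → z ∈ q
  internal-enclose q (z∈ , z≢a , z≢a*) with ∈-enclose⁻ q z∈
  ... | inj₁ z≡a = ⊥-elim (z≢a z≡a)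
  ... | inj₂ (inj₁ z∈q) = z∈q
  ... | inj₂ (inj₂ z≡a*) = ⊥-elim (z≢a* z≡a*)

  Unique-enclose : ∀ {a a* q} → a ∉ q → a* ∉ q → a ≢ a* → Unique q → Unique (enclose a q a*)
  Unique-enclose {a} {a*} {q} a∉ a*∉ a≢a* u-q =
    All.tabulate a≢ ∷ Unique.++⁺ u-q ([] ∷ []) λ { (z∈q , here refl) → a*∉ z∈q }
    where
    a≢ : ∀ {z} → z ∈ q ++ [ a* ] → a ≢ z
    a≢ z∈ with ∈-++⁻ q z∈
    ... | inj₁ z∈q = λ { refl → a∉ z∈q }
    ... | inj₂ (here refl) = a≢a*

  Unique-enclose⁻ : ∀ {a a* q} → Unique (enclose a q a*) → a ∉ q × a* ∉ q
  Unique-enclose⁻ {q = q} (a∉ ∷ u) =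
    (λ a∈q → All.lookup a∉ (∈-++⁺ˡ a∈q) refl) ,
    (λ a*∈q → proj₂ (proj₂ (Unique-++⁻ q u)) (a*∈q , here refl))

  Subpath-⊆ : {rs ws : List A} → Subpath rs ws → rs ⊆ ws
  Subpath-⊆ (pre , suf , refl) = mid⊆pre++mid++suf pre

  Subpath-++ˡ : ∀ xs {rs ys : List A} → Subpath rs ys → Subpath rs (xs ++ ys)
  Subpath-++ˡ xs (pre , suf , refl) = xs ++ pre , suf , sym (++-assoc xs pre _)

  Subpath-++ʳ : ∀ {rs xs : List A} ys → Subpath rs xs → Subpath rs (xs ++ ys)
  Subpath-++ʳ {rs} ys (pre , suf , refl) =
    pre , suf ++ ys , trans (++-assoc pre _ ys) (cong (pre ++_) (++-assoc rs suf ys))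

  prefix-before : ∀ {r} (S : List A) {zs} xs {ys} → S ++ zs ≡ xs ++ r ∷ ys → r ∉ S →
                  Σ (List A) λ d → xs ≡ S ++ d
  prefix-before [] xs _ _ = xs , refl
  prefix-before (s ∷ S) [] refl r∉ = ⊥-elim (r∉ (here refl))
  prefix-before (s ∷ S) (x ∷ xs) eq r∉ with ∷-injective eq
  ... | refl , eq′ with prefix-before S xs eq′ (r∉ ∘ there)
  ...   | d , refl = d , refl

  Subpath-drop : ∀ xs {s : A} {S ys} → Subpath (s ∷ S) (xs ++ ys) → s ∉ xs → Subpath (s ∷ S) ys
  Subpath-drop [] sp _ = sp
  Subpath-drop (x ∷ xs) ([] , suf , eq) s∉ = ⊥-elim (s∉ (here (proj₁ (∷-injective (sym eq)))))
  Subpath-drop (x ∷ xs) (_ ∷ pre , suf , eq) s∉ =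
    Subpath-drop xs (pre , suf , proj₂ (∷-injective eq)) (s∉ ∘ there)

  Subpath-avoiding : ∀ pre {s r : A} {S R suf} → Subpath (s ∷ S) (pre ++ (r ∷ R) ++ suf) →
                     s ∉ r ∷ R → r ∉ s ∷ S → Subpath (s ∷ S) pre ⊎ Subpath (s ∷ S) suf
  Subpath-avoiding [] sp s∉ _ = inj₂ (Subpath-drop (_ ∷ _) sp s∉)
  Subpath-avoiding (x ∷ pre) ([] , suf , eq) _ r∉ with prefix-before (_ ∷ _) (x ∷ pre) (sym eq) r∉
  ... | d , x∷pre≡ = inj₁ ([] , d , x∷pre≡)
  Subpath-avoiding (x ∷ pre) (_ ∷ pre′ , suf′ , eq) s∉ r∉
    with ∷-injective eq
  ... | refl , eq′ with Subpath-avoiding pre (pre′ , suf′ , eq′) s∉ r∉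
  ...   | inj₁ sp = inj₁ (Subpath-++ˡ [ x ] sp)
  ...   | inj₂ sp = inj₂ sp

  Subpath-reroute : ∀ pre {s r : A} {S R suf} (P : List A) → Subpath (s ∷ S) (pre ++ (r ∷ R) ++ suf) →
                    Disjoint (s ∷ S) (r ∷ R) → Subpath (s ∷ S) (pre ++ P ++ suf)
  Subpath-reroute pre P sp S#R
    with Subpath-avoiding pre sp (λ s∈ → S#R (here refl , s∈)) (λ r∈ → S#R (r∈ , here refl))
  ... | inj₁ sp′ = Subpath-++ʳ (P ++ _) sp′
  ... | inj₂ sp′ = Subpath-++ˡ pre (Subpath-++ˡ P sp′)

  end-or-internal : DecidableEquality A → ∀ {a b z} xs → z ∈ xs → z ≡ a ⊎ z ≡ b ⊎ Internal a b xs z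
  end-or-internal _≟ᴬ_ {a} {b} {z} xs z∈ with z ≟ᴬ a | z ≟ᴬ b
  ... | yes z≡a | _ = inj₁ z≡a
  ... | no _ | yes z≡b = inj₂ (inj₁ z≡b)
  ... | no z≢a | no z≢b = inj₂ (inj₂ (z∈ , z≢a , z≢b))

module _ {D : Digraph} where

  walk-head : ∀ {s t x xs} → IsWalk D s t (x ∷ xs) → s ≡ x
  walk-head here = refl
  walk-head (step _ _) = refl

  walk-first : ∀ {a b R} → IsWalk D a b R → a ∈ R
  walk-first here = here refl
  walk-first (step _ _) = here refl

  walk-last : ∀ {a b R} → IsWalk D a b R → b ∈ R
  walk-last here = here refl
  walk-last (step _ w) = there (walk-last w)

  walk-++ : ∀ {s y t xs ys} → IsWalk D s y xs → IsWalk D y t (y ∷ ys) → IsWalk D s t (xs ++ ys)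
  walk-++ here w = w
  walk-++ (step e w₁) w₂ = step e (walk-++ w₁ w₂)

  walk-split : ∀ xs {s t y ys} → IsWalk D s t (xs ++ y ∷ ys) →
               IsWalk D s y (xs ++ [ y ]) × IsWalk D y t (y ∷ ys)
  walk-split [] w with walk-head w
  ... | refl = here , w
  walk-split (_ ∷ []) (step e w) with walk-head w
  ... | refl = step e here , w
  walk-split (_ ∷ x ∷ xs) (step e w) with walk-head w
  ... | refl = let (w₁ , w₂) = walk-split (x ∷ xs) w in step e w₁ , w₂

  walk-join : ∀ xs {s y t ys} → IsWalk D s y (xs ++ [ y ]) → IsWalk D y t ys → IsWalk D s t (xs ++ ys)
  walk-join [] here w = w
  walk-join (_ ∷ []) (step e here) w = step e w
  walk-join (_ ∷ x ∷ xs) (step e w₁) w₂ with walk-head w₁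
  ... | refl = step e (walk-join (x ∷ xs) w₁ w₂)

  walk-drop : ∀ {a b t R suf} → IsWalk D a b R → IsWalk D a t (R ++ suf) → IsWalk D b t (b ∷ suf)
  walk-drop here w = w
  walk-drop (step _ here) (step _ w) with walk-head w
  ... | refl = w
  walk-drop (step _ r@(step _ _)) (step _ w) with walk-head w
  ... | refl = walk-drop r w

  walk-enclose : ∀ {a b b* a* q} → Arc D a b → IsWalk D b b* q → Arc D b* a* →
                 IsWalk D a a* (enclose a q a*)
  walk-enclose ab q ba = step ab (walk-++ q (step ba here))

  path-enclose : ∀ {a b b* a* q} → Arc D a b → IsPath D b b* q → Arc D b* a* →
                 a ∉ q → a* ∉ q → a ≢ a* → IsPath D a a* (enclose a q a*)
  path-enclose ab (q , u-q) ba a∉ a*∉ a≢a* = walk-enclose ab q ba , Unique-enclose a∉ a*∉ a≢a* u-q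

  walk-reroute : ∀ pre {s t a b R P suf} → IsWalk D s t (pre ++ (a ∷ R) ++ suf) →
                 IsWalk D a b (a ∷ R) → IsWalk D a b P → IsWalk D s t (pre ++ P ++ suf)
  walk-reroute pre w r p =
    walk-join pre (proj₁ (walk-split pre w)) (walk-++ p (walk-drop r (proj₂ (walk-split pre w))))

  path-reroute : ∀ pre {s t a b R P suf} → IsPath D s t (pre ++ (a ∷ R) ++ suf) →
                 IsWalk D a b (a ∷ R) → IsPath D a b P →
                 (∀ z → Internal a b P z → z ∉ pre ++ (a ∷ R) ++ suf) → IsPath D s t (pre ++ P ++ suf)
  path-reroute pre {a = a} {b} {R} {P} {suf} (w , u) r (p , u-P) P-off =
    walk-reroute pre w r p , Unique-unshift pre {P} (Unique.++⁺ u-P u-out P#out)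
    where
    u-out : Unique (pre ++ suf)
    u-out = proj₁ (proj₂ (Unique-++⁻ (a ∷ R) (Unique-shift pre {a ∷ R} u)))

    R#out : Disjoint (a ∷ R) (pre ++ suf)
    R#out = proj₂ (proj₂ (Unique-++⁻ (a ∷ R) (Unique-shift pre {a ∷ R} u)))

    P#out : Disjoint P (pre ++ suf)
    P#out (z∈P , z∈out) with end-or-internal _≟_ {a} {b} P z∈P
    ... | inj₁ refl = R#out (walk-first r , z∈out)
    ... | inj₂ (inj₁ refl) = R#out (walk-last r , z∈out)
    ... | inj₂ (inj₂ int) = P-off _ int (pre++suf⊆pre++mid++suf pre z∈out)

-- A ladder indexed by its rungs: even m, odd m and Q m stand for v_{2m},
-- v_{2m+1} and Q_{2m+1}, and similarly for the starred vertices.  Only the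
-- facts about later rungs are recorded, which makes the notion stable under
-- dropping the first rung.
record RungLadder (D : Digraph) (k : ℕ) : Set where
  field
    even even* odd odd* : ℕ → V D
    Q : ℕ → List (V D)
    even→odd   : ∀ m → m < k → Arc D (even m) (odd m)
    odd*→even* : ∀ m → m < k → Arc D (odd* m) (even* m)
    next→odd   : ∀ m → m < k → Arc D (even (suc m)) (odd m)
    odd*→next  : ∀ m → m < k → Arc D (odd* m) (even* (suc m))
    top-arc    : Arc D (even k) (even* k)
    odd-path   : ∀ m → m < k → IsPath D (odd m) (odd* m) (Q m)
    even≢even* : ∀ j → j ≤ k → even j ≢ even* j
    rung-avoids-later : ∀ m → m < k → ∀ {z} → z ∈ enclose (even m) (Q m) (even* m) →
                        ∀ j → m < j → j ≤ k → z ≢ even j × z ≢ even* j × (j < k → z ∉ Q j)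

module _ {D : Digraph} {k : ℕ} (L : RungLadder D k) where
  open RungLadder L

  ladderRung : ℕ → List (V D)
  ladderRung m = enclose (even m) (Q m) (even* m)

  ladderTop : List (V D)
  ladderTop = enclose (even k) [] (even* k)

  LiesOn : List (V D) → Set
  LiesOn W = (∀ m → m < k → Subpath (ladderRung m) W) × Subpath ladderTop W

  rung-ends-∈ : ∀ {W} → LiesOn W → ∀ j → j ≤ k → even j ∈ W × even* j ∈ W
  rung-ends-∈ (rungs , top) j j≤k with j ≟ℕ k
  ... | yes refl = Subpath-⊆ top (here refl) , Subpath-⊆ top (there (here refl))
  ... | no j≢k = Subpath-⊆ on-j (here refl) , Subpath-⊆ on-j (there (∈-++⁺ʳ (Q j) (here refl)))
    where
    on-j : Subpath (ladderRung j) _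
    on-j = rungs j (≤∧≢⇒< j≤k j≢k)

  later-rung-disjoint : ∀ {m j} → m < j → j < k → Disjoint (ladderRung j) (ladderRung m)
  later-rung-disjoint {m} {j} m<j j<k (z∈j , z∈m)
    with rung-avoids-later m (<-trans m<j j<k) z∈m j m<j (<⇒≤ j<k)
  ... | ≢even , ≢even* , ∉Q with ∈-enclose⁻ (Q j) z∈j
  ...   | inj₁ z≡even = ≢even z≡even
  ...   | inj₂ (inj₁ z∈Q) = ∉Q j<k z∈Q
  ...   | inj₂ (inj₂ z≡even*) = ≢even* z≡even*

  top-disjoint : ∀ {m} → m < k → Disjoint ladderTop (ladderRung m)
  top-disjoint {m} m<k (z∈top , z∈m) with rung-avoids-later m m<k z∈m k m<k ≤-refl | z∈top
  ... | ≢even , _ , _ | here z≡even = ≢even z≡even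
  ... | _ , ≢even* , _ | there (here z≡even*) = ≢even* z≡even*

dropRung : ∀ {D k} → RungLadder D (suc k) → RungLadder D k
dropRung L = record
  { even = even ∘ suc ; even* = even* ∘ suc ; odd = odd ∘ suc ; odd* = odd* ∘ suc ; Q = Q ∘ suc
  ; even→odd = λ m m<k → even→odd (suc m) (s≤s m<k)
  ; odd*→even* = λ m m<k → odd*→even* (suc m) (s≤s m<k)
  ; next→odd = λ m m<k → next→odd (suc m) (s≤s m<k)
  ; odd*→next = λ m m<k → odd*→next (suc m) (s≤s m<k)
  ; top-arc = top-arc
  ; odd-path = λ m m<k → odd-path (suc m) (s≤s m<k)
  ; even≢even* = λ j j≤k → even≢even* (suc j) (s≤s j≤k)
  ; rung-avoids-later = λ m m<k z∈ j m<j j≤k →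
      let (≢even , ≢even* , ∉Q) = rung-avoids-later (suc m) (s≤s m<k) z∈ (suc j) (s≤s m<j) (s≤s j≤k)
      in ≢even , ≢even* , ∉Q ∘ s≤s
  }
  where open RungLadder L

module _ {D : Digraph} {k : ℕ} (L : RungLadder D (suc k)) where
  open RungLadder L

  private
    0<1+k : 0 < suc k
    0<1+k = s≤s z≤n

    1≤1+k : 1 ≤ suc k
    1≤1+k = s≤s z≤n

    Q₀-avoids-next : ∀ {z} → z ∈ Q 0 → z ≢ even 1 × z ≢ even* 1
    Q₀-avoids-next z∈Q =
      let (≢even , ≢even* , _) = rung-avoids-later 0 0<1+k (⊆-enclose (Q 0) z∈Q) 1 (s≤s z≤n) 1≤1+k
      in ≢even , ≢even*

  detour : List (V D)
  detour = enclose (even 1) (Q 0) (even* 1)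

  detour-path : IsPath D (even 1) (even* 1) detour
  detour-path = path-enclose (next→odd 0 0<1+k) (odd-path 0 0<1+k) (odd*→next 0 0<1+k)
    (λ even∈Q → proj₁ (Q₀-avoids-next even∈Q) refl)
    (λ even*∈Q → proj₂ (Q₀-avoids-next even*∈Q) refl)
    (even≢even* 1 1≤1+k)

  reroute-first-rung : ∀ {s t W P} → IsPath D s t W → LiesOn L W → IsPath D (even 0) (even* 0) P →
    (∀ z → Internal (even 0) (even* 0) P z → z ∉ W) →
    Σ (List (V D)) λ W₁ → IsPath D s t W₁ × LiesOn (dropRung L) W₁ ×
      (∀ z → Internal (even 1) (even* 1) detour z → z ∉ W₁) ×
      W₁ ++ detour ⊆ W ++ P × W ++ P ⊆ W₁ ++ detour
  reroute-first-rung {P = P} W-path@(_ , u) on@(rungs , top) P-path@(p , _) P-off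
    with rungs 0 0<1+k
  ... | pre , suf , refl =
    pre ++ P ++ suf ,
    path-reroute pre W-path R₀-walk P-path P-off ,
    ((λ m m<k → Subpath-reroute pre P (rungs (suc m) (s≤s m<k))
                                 (later-rung-disjoint L (s≤s z≤n) (s≤s m<k))) ,
     Subpath-reroute pre P top (top-disjoint L 0<1+k)) ,
    (λ z int → Q₀∉W₁ (internal-enclose (Q 0) int)) ,
    ++-⊆ (swap-middle-⊆ pre (xs⊆ys++xs P R₀)) (⊆-trans detour⊆W (xs⊆xs++ys _ P)) ,
    ++-⊆ (swap-middle-⊆ pre R₀⊆P++detour) (⊆-trans (mid⊆pre++mid++suf pre) (xs⊆xs++ys _ detour))
    where
    R₀ : List (V D)
    R₀ = ladderRung L 0

    R₀-walk : IsWalk D (even 0) (even* 0) R₀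
    R₀-walk = walk-enclose (even→odd 0 0<1+k) (proj₁ (odd-path 0 0<1+k)) (odd*→even* 0 0<1+k)

    R₀#out : Disjoint R₀ (pre ++ suf)
    R₀#out = proj₂ (proj₂ (Unique-++⁻ R₀ (Unique-shift pre {R₀} u)))

    ends∉Q₀ : even 0 ∉ Q 0 × even* 0 ∉ Q 0
    ends∉Q₀ = Unique-enclose⁻ (proj₁ (Unique-++⁻ R₀ (Unique-shift pre {R₀} u)))

    Q₀∉W₁ : ∀ {z} → z ∈ Q 0 → z ∉ pre ++ P ++ suf
    Q₀∉W₁ z∈Q z∈W₁ with ∈-middle⁻ pre z∈W₁
    ... | inj₂ z∈out = R₀#out (⊆-enclose (Q 0) z∈Q , z∈out)
    ... | inj₁ z∈P with end-or-internal _≟_ {even 0} {even* 0} P z∈P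
    ...   | inj₁ refl = proj₁ ends∉Q₀ z∈Q
    ...   | inj₂ (inj₁ refl) = proj₂ ends∉Q₀ z∈Q
    ...   | inj₂ (inj₂ int) = P-off _ int (mid⊆pre++mid++suf pre (⊆-enclose (Q 0) z∈Q))

    detour⊆W : detour ⊆ pre ++ R₀ ++ suf
    detour⊆W = enclose-⊆ (proj₁ (rung-ends-∈ L on 1 1≤1+k))
                         (⊆-trans (⊆-enclose (Q 0)) (mid⊆pre++mid++suf pre))
                         (proj₂ (rung-ends-∈ L on 1 1≤1+k))

    R₀⊆P++detour : R₀ ⊆ P ++ detour
    R₀⊆P++detour = enclose-⊆ (∈-++⁺ˡ (walk-first p)) (⊆-trans (⊆-enclose (Q 0)) (xs⊆ys++xs detour P))
                             (∈-++⁺ˡ (walk-last p))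

ladder-reroute : ∀ {D} k (L : RungLadder D k) {s t W P} → IsPath D s t W → LiesOn L W →
  IsPath D (RungLadder.even L 0) (RungLadder.even* L 0) P →
  (∀ z → Internal (RungLadder.even L 0) (RungLadder.even* L 0) P z → z ∉ W) →
  Σ (List (V D)) λ W′ → IsPath D s t W′ × W′ ⊆ W ++ P × W ++ P ⊆ W′
ladder-reroute zero L {P = P} W-path (_ , pre , suf , refl) P-path@(p , _) P-off =
  pre ++ P ++ suf ,
  path-reroute pre W-path (step (RungLadder.top-arc L) here) P-path P-off ,
  swap-middle-⊆ pre (xs⊆ys++xs P (ladderTop L)) ,
  ++-⊆ (++⁺ʳ pre (++⁺ˡ suf (enclose-⊆ {q = []} (walk-first p) (λ ()) (walk-last p))))
       (mid⊆pre++mid++suf pre)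
ladder-reroute (suc k) L W-path on P-path P-off
  with reroute-first-rung L W-path on P-path P-off
... | W₁ , W₁-path , on₁ , detour-off , ⊆₁ , ⊇₁
  with ladder-reroute k (dropRung L) W₁-path on₁ (detour-path L) detour-off
... | W′ , W′-path , ⊆₂ , ⊇₂ = W′ , W′-path , ⊆-trans ⊆₂ ⊆₁ , ⊆-trans ⊇₁ ⊇₂

odd<even : ∀ {m j} → m < j → suc (2 * m) < 2 * j
odd<even {m} {j} m<j = subst (_≤ 2 * j) (*-suc 2 m) (*-monoʳ-≤ 2 m<j)

module _ {D : Digraph} {x x* : V D} (L : Ladder D x x*) where

  Labelled : V D → ℕ → Set
  Labelled z i = z ≡ v L i ⊎ z ≡ v* L i

  labelled-injective : ∀ {z i j} → i ≤ 2 * k L → j ≤ 2 * k L → Labelled z i → Labelled z j → i ≡ j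
  labelled-injective i≤ j≤ (inj₁ refl) (inj₁ e) = v-inj L _ _ i≤ j≤ e
  labelled-injective i≤ j≤ (inj₁ refl) (inj₂ e) = ⊥-elim (v-v* L _ _ i≤ j≤ e)
  labelled-injective i≤ j≤ (inj₂ refl) (inj₁ e) = ⊥-elim (v-v* L _ _ j≤ i≤ (sym e))
  labelled-injective i≤ j≤ (inj₂ refl) (inj₂ e) = v*-inj L _ _ i≤ j≤ e

  Q-internal : ℕ → V D → Set
  Q-internal m = Internal (v L (suc (2 * m))) (v* L (suc (2 * m))) (Qs L m)

  Q-internal-unlabelled : ∀ {m z i} → m < k L → Q-internal m z → i ≤ 2 * k L → ¬ Labelled z i
  Q-internal-unlabelled m<k int i≤ (inj₁ e) = proj₁ (Q-int L _ m<k _ int) _ i≤ e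
  Q-internal-unlabelled m<k int i≤ (inj₂ e) = proj₂ (Q-int L _ m<k _ int) _ i≤ e

  Q-vertex : ∀ {m z} → z ∈ Qs L m → Labelled z (suc (2 * m)) ⊎ Q-internal m z
  Q-vertex {m} z∈Q with end-or-internal _≟_ {v L (suc (2 * m))} {v* L (suc (2 * m))} (Qs L m) z∈Q
  ... | inj₁ e = inj₁ (inj₁ e)
  ... | inj₂ (inj₁ e) = inj₁ (inj₂ e)
  ... | inj₂ (inj₂ int) = inj₂ int

  rung-vertex : ∀ {m z} → z ∈ rung L m → (Σ ℕ λ i → i ≤ suc (2 * m) × Labelled z i) ⊎ Q-internal m z
  rung-vertex {m} z∈ with ∈-enclose⁻ (Qs L m) z∈
  ... | inj₁ e = inj₁ (2 * m , n≤1+n _ , inj₁ e)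
  ... | inj₂ (inj₂ e) = inj₁ (2 * m , n≤1+n _ , inj₂ e)
  ... | inj₂ (inj₁ z∈Q) with Q-vertex z∈Q
  ...   | inj₁ lab = inj₁ (suc (2 * m) , ≤-refl , lab)
  ...   | inj₂ int = inj₂ int

  rung-unlabelled-beyond : ∀ {m z i} → m < k L → z ∈ rung L m → suc (2 * m) < i → i ≤ 2 * k L →
                           ¬ Labelled z i
  rung-unlabelled-beyond m<k z∈ odd<i i≤ lab with rung-vertex z∈
  ... | inj₁ (i′ , i′≤odd , lab′) =
        <-irrefl (labelled-injective (≤-trans (<⇒≤ i′<i) i≤) i≤ lab′ lab) i′<i
    where i′<i = ≤-<-trans i′≤odd odd<i
  ... | inj₂ int = Q-internal-unlabelled m<k int i≤ lab

  rung-avoids-Q : ∀ {m j z} → m < j → j < k L → z ∈ rung L m → z ∉ Qs L j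
  rung-avoids-Q {m} {j} m<j j<k z∈ z∈Q with Q-vertex z∈Q
  ... | inj₁ lab =
        rung-unlabelled-beyond m<k z∈ (≤-trans (odd<even m<j) (n≤1+n _)) (<⇒≤ (odd<even j<k)) lab
    where m<k = <-trans m<j j<k
  ... | inj₂ int with rung-vertex z∈
  ...   | inj₁ (i , i≤odd , lab) =
          Q-internal-unlabelled j<k int (≤-trans i≤odd (<⇒≤ (odd<even (<-trans m<j j<k)))) lab
  ...   | inj₂ int′ =
          Q-disj L m j (<-trans m<j j<k) j<k (λ { refl → <-irrefl refl m<j }) _ (proj₁ int′) z∈Q

  toRungLadder : RungLadder D (k L)
  toRungLadder = record
    { even = λ m → v L (2 * m) ; even* = λ m → v* L (2 * m)
    ; odd = λ m → v L (suc (2 * m)) ; odd* = λ m → v* L (suc (2 * m))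
    ; Q = Qs L
    ; even→odd = arc-even L
    ; odd*→even* = arc-even* L
    ; next→odd = λ m m<k →
        subst (λ i → Arc D (v L i) (v L (suc (2 * m)))) (sym (*-suc 2 m)) (arc-odd L m m<k)
    ; odd*→next = λ m m<k →
        subst (λ i → Arc D (v* L (suc (2 * m))) (v* L i)) (sym (*-suc 2 m)) (arc-odd* L m m<k)
    ; top-arc = arc-top L
    ; odd-path = Q-path L
    ; even≢even* = λ j j≤k → v-v* L _ _ (*-monoʳ-≤ 2 j≤k) (*-monoʳ-≤ 2 j≤k)
    ; rung-avoids-later = λ m m<k z∈ j m<j j≤k →
        let beyond = rung-unlabelled-beyond m<k z∈ (odd<even m<j) (*-monoʳ-≤ 2 j≤k)
        in beyond ∘ inj₁ , beyond ∘ inj₂ , λ j<k → rung-avoids-Q m<j j<k z∈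
    }

module _ {H D : Digraph} (S : Subdivision H D) {u w : V H} (a : Arc H u w) (W′ : List (V D))
         (W′-path : IsPath D (f S u) (f S w) W′) (W⊆W′ : g S u w a ⊆ W′)
         (W′-fresh : ∀ {z} → z ∈ W′ → z ∈ g S u w a ⊎ ¬ InSub S z) where

  private
    _≟ᴬ_ : DecidableEquality (V H × V H)
    _≟ᴬ_ = ≡-dec _≟_ _≟_

    g′ : (u′ w′ : V H) → Arc H u′ w′ → List (V D)
    g′ u′ w′ a′ with (u′ , w′) ≟ᴬ (u , w)
    ... | yes _ = W′
    ... | no _ = g S u′ w′ a′

    g′-replaced : ∀ a′ → g′ u w a′ ≡ W′
    g′-replaced a′ with (u , w) ≟ᴬ (u , w)
    ... | yes _ = refl
    ... | no ≢ = ⊥-elim (≢ refl)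

    g′-kept : ∀ {u′ w′} a′ → (u′ , w′) ≢ (u , w) → g′ u′ w′ a′ ≡ g S u′ w′ a′
    g′-kept {u′} {w′} a′ ≢ with (u′ , w′) ≟ᴬ (u , w)
    ... | yes ≡ = ⊥-elim (≢ ≡)
    ... | no _ = refl

    g′-path : ∀ u′ w′ (a′ : Arc H u′ w′) → IsPath D (f S u′) (f S w′) (g′ u′ w′ a′)
    g′-path u′ w′ a′ with (u′ , w′) ≟ᴬ (u , w)
    ... | yes refl = W′-path
    ... | no _ = g-path S u′ w′ a′

    new-old : ∀ u₂ w₂ (a₂ : Arc H u₂ w₂) → (u₂ , w₂) ≢ (u , w) →
              IntDisjoint (f S u) (f S w) W′ (f S u₂) (f S w₂) (g S u₂ w₂ a₂)
    new-old u₂ w₂ a₂ ≢ = new∉old , old∉new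
      where
      old : IntDisjoint (f S u) (f S w) (g S u w a) (f S u₂) (f S w₂) (g S u₂ w₂ a₂)
      old = g-disj S u w a u₂ w₂ a₂ (≢ ∘ sym)

      new∉old : ∀ z → Internal (f S u) (f S w) W′ z → z ∉ g S u₂ w₂ a₂
      new∉old z (z∈ , z≢u , z≢w) z∈old with W′-fresh z∈
      ... | inj₁ z∈W = proj₁ old z (z∈W , z≢u , z≢w) z∈old
      ... | inj₂ z∉S = z∉S (inj₂ (u₂ , w₂ , a₂ , z∈old))

      old∉new : ∀ z → Internal (f S u₂) (f S w₂) (g S u₂ w₂ a₂) z → z ∉ W′
      old∉new z int z∈ with W′-fresh z∈
      ... | inj₁ z∈W = proj₂ old z int z∈W
      ... | inj₂ z∉S = z∉S (inj₂ (u₂ , w₂ , a₂ , proj₁ int))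

    g′-disj : ∀ u₁ w₁ (a₁ : Arc H u₁ w₁) u₂ w₂ (a₂ : Arc H u₂ w₂) → (u₁ , w₁) ≢ (u₂ , w₂) →
              IntDisjoint (f S u₁) (f S w₁) (g′ u₁ w₁ a₁) (f S u₂) (f S w₂) (g′ u₂ w₂ a₂)
    g′-disj u₁ w₁ a₁ u₂ w₂ a₂ ≢ with (u₁ , w₁) ≟ᴬ (u , w) | (u₂ , w₂) ≟ᴬ (u , w)
    ... | yes refl | yes refl = ⊥-elim (≢ refl)
    ... | yes refl | no ≢₂ = new-old u₂ w₂ a₂ ≢₂
    ... | no ≢₁ | yes refl = swap (new-old u₁ w₁ a₁ ≢₁)
    ... | no _ | no _ = g-disj S u₁ w₁ a₁ u₂ w₂ a₂ ≢

  replacePath : Subdivision H D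
  replacePath = record { f = f S ; f-inj = f-inj S ; g = g′ ; g-path = g′-path ; g-disj = g′-disj }

  InSub-replacePath : ∀ z → InSub replacePath z ⇔ (InSub S z ⊎ z ∈ W′)
  InSub-replacePath z = mk⇔ to from
    where
    to : InSub replacePath z → InSub S z ⊎ z ∈ W′
    to (inj₁ branch) = inj₁ (inj₁ branch)
    to (inj₂ (u′ , w′ , a′ , z∈)) with (u′ , w′) ≟ᴬ (u , w)
    ... | yes _ = inj₂ z∈
    ... | no _ = inj₁ (inj₂ (u′ , w′ , a′ , z∈))

    from : InSub S z ⊎ z ∈ W′ → InSub replacePath z
    from (inj₁ (inj₁ branch)) = inj₁ branch
    from (inj₁ (inj₂ (u′ , w′ , a′ , z∈))) with (u′ , w′) ≟ᴬ (u , w)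
    ... | yes refl = inj₂ (u , w , a′ , subst (z ∈_) (sym (g′-replaced a′)) (W⊆W′ z∈W))
      where
      z∈W : z ∈ g S u w a
      z∈W = subst (λ a″ → z ∈ g S u w a″) (T-irrelevant a′ a) z∈
    ... | no ≢ = inj₂ (u′ , w′ , a′ , subst (z ∈_) (sym (g′-kept a′ ≢)) z∈)
    from (inj₂ z∈W′) = inj₂ (u , w , a , subst (z ∈_) (sym (g′-replaced a)) z∈W′)

lemma2p9 : (H D : Digraph) (x x* : V D) → x ≢ x* →
    (L : Ladder D x x*) (H' : Subdivision H D) → EmbeddedIn L H' →
    (P : List (V D)) → IsPath D x x* P →
    (∀ z → Internal x x* P z → ¬ InSub H' z) →
    Σ (Subdivision H D) λ H'' →
      (∀ z → IsBranch H'' z ⇔ IsBranch H' z) ×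
      (∀ z → InSub H'' z ⇔ (InSub H' z ⊎ z ∈ P))
lemma2p9 H D x x* _ L H' (u , w , a , on-W) P P-path P-avoids
  with ladder-reroute (k L) (toRungLadder L) (g-path H' u w a) on-W
         (subst₂ (λ s t → IsPath D s t P) (sym (start L)) (sym (start* L)) P-path)
         (λ z int z∈W → P-avoids z (subst₂ (λ s t → Internal s t P z) (start L) (start* L) int)
                                   (inj₂ (u , w , a , z∈W)))
... | W′ , W′-path , W′⊆W++P , W++P⊆W′ =
  replacePath H' a W′ W′-path W⊆W′ W′-fresh ,
  (λ _ → mk⇔ id id) ,
  λ z → Equivalence.trans (InSub-replacePath H' a W′ W′-path W⊆W′ W′-fresh z) (mk⇔ W′→P P→W′)
  where
  W : List (V D)
  W = g H' u w a

  W⊆W′ : W ⊆ W′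
  W⊆W′ = W++P⊆W′ ∘ ∈-++⁺ˡ

  ends∈W : x ∈ W × x* ∈ W
  ends∈W = let (v₀∈W , v₀*∈W) = rung-ends-∈ (toRungLadder L) on-W 0 z≤n
           in subst (_∈ W) (start L) v₀∈W , subst (_∈ W) (start* L) v₀*∈W

  W′-fresh : ∀ {z} → z ∈ W′ → z ∈ W ⊎ ¬ InSub H' z
  W′-fresh z∈ with ∈-++⁻ W (W′⊆W++P z∈)
  ... | inj₁ z∈W = inj₁ z∈W
  ... | inj₂ z∈P with end-or-internal _≟_ {x} {x*} P z∈P
  ...   | inj₁ refl = inj₁ (proj₁ ends∈W)
  ...   | inj₂ (inj₁ refl) = inj₁ (proj₂ ends∈W)
  ...   | inj₂ (inj₂ int) = inj₂ (P-avoids _ int)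

  W′→P : ∀ {z} → InSub H' z ⊎ z ∈ W′ → InSub H' z ⊎ z ∈ P
  W′→P (inj₁ z∈H′) = inj₁ z∈H′
  W′→P (inj₂ z∈W′) with ∈-++⁻ W (W′⊆W++P z∈W′)
  ... | inj₁ z∈W = inj₁ (inj₂ (u , w , a , z∈W))
  ... | inj₂ z∈P = inj₂ z∈P

  P→W′ : ∀ {z} → InSub H' z ⊎ z ∈ P → InSub H' z ⊎ z ∈ W′
  P→W′ (inj₁ z∈H′) = inj₁ z∈H′
  P→W′ (inj₂ z∈P) = inj₂ (W++P⊆W′ (∈-++⁺ʳ W z∈P))
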